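{- If $k$ is odd and $U$ is a $k$-unitrade, then $|U|$ is even.
   Context: A $k$-unitrade on a finite set $V$ is a collection $U$ of $k$-element subsets of $V$ such that every $(k-1)$-element subset of $V$ is contained in an even number of blocks of $U$. -}

module Defs where

open import Data.Nat using (ℕ; suc)
open import Data.Nat.Divisibility using (_∣_)
open import Data.Fin.Subset using (Subset; _⊆_; ∣_∣)
open import Data.Fin.Subset.Properties using (_⊆?_)
open import Data.List using (List; length; filter)
open import Data.List.Relation.Unary.All using (All)
open import Data.List.Relation.Unary.Unique.Propositional using (Unique)
open import Relation.Binary.PropositionalEquality using (_≡_)
open import Relation.Nullary using (¬_)

-- The ground set V is taken to be Fin n (any finite set is in bijection with one).
-- A collection of subsets of V is a duplicate-free list of subsets.

Even : ℕ → Set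
Even m = 2 ∣ m

Odd : ℕ → Set
Odd m = ¬ (2 ∣ m)

blocksContaining : {n : ℕ} → Subset n → List (Subset n) → ℕ
blocksContaining T U = length (filter (T ⊆?_) U)

record IsUnitrade (n k : ℕ) (U : List (Subset n)) : Set where
  field
    distinct   : Unique U
    blockSize  : All (λ B → ∣ B ∣ ≡ k) U
    evenCover  : (T : Subset n) → suc ∣ T ∣ ≡ k → Even (blocksContaining T U)

module Submission where

open import Defs
open import Function using (_∘_)
open import Data.Bool using (Bool; true; false)
open import Data.Nat using (ℕ; zero; suc; _+_; _*_; _∸_)
open import Data.Nat.Properties
  using (+-comm; +-identityʳ; +-commutativeSemigroup; *-zeroʳ; *-distribˡ-+; m+n∸n≡m; n≤1+n; _≟_)
open import Algebra.Properties.CommutativeSemigroup +-commutativeSemigroup using (interchange)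
open import Data.Nat.Divisibility using (_∣0; ∣m∣n⇒∣m+n)
open import Data.Nat.Primality using (prime?; euclidsLemma)
open import Data.Nat.Combinatorics using (_C_; nCk≡nC[n∸k]; nC1≡n; nCk+nC[k+1]≡[n+1]C[k+1])
open import Data.Nat.ListAction using (sum)
open import Data.Nat.ListAction.Properties using (sum-++)
open import Data.Fin.Subset using (Subset; ∣_∣; inside; outside)
open import Data.Fin.Subset.Properties using (_⊆?_)
open import Data.Vec using ([]; _∷_)
open import Data.List using (List; length; filter; map; _++_) renaming ([] to []ˡ; _∷_ to _∷ˡ_)
open import Data.List.Properties using (map-++; map-∘; map-cong; map-cong-local)
open import Data.List.Relation.Unary.All using (All)
open import Data.Sum using (inj₁; inj₂)
open import Data.Empty using (⊥-elim)
open import Relation.Nullary using (Dec; does; yes; no)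
open import Relation.Nullary.Decidable using (from-yes)
open import Relation.Unary using (Decidable)
open import Relation.Binary.PropositionalEquality
  using (_≡_; refl; sym; trans; cong; cong₂; subst; module ≡-Reasoning)

open ≡-Reasoning

-- Count the pairs (T , B) with B a block of U and T ⊆ B a (k-1)-subset.  Every block
-- contains exactly k such T, and every (k-1)-subset lies in an even number of blocks,
-- so k·|U| is even; as k is odd, |U| is even.

χ : Bool → ℕ
χ true  = 1
χ false = 0

∑ : {A : Set} → List A → (A → ℕ) → ℕ
∑ xs f = sum (map f xs)

private
  variable
    A B : Set

∑-++ : (xs ys : List A) (f : A → ℕ) → ∑ (xs ++ ys) f ≡ ∑ xs f + ∑ ys f
∑-++ xs ys f = trans (cong sum (map-++ f xs ys)) (sum-++ (map f xs) (map f ys))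

∑-map : (g : A → B) (xs : List A) (f : B → ℕ) → ∑ (map g xs) f ≡ ∑ xs (f ∘ g)
∑-map g xs f = cong sum (sym (map-∘ xs))

∑-cong : (xs : List A) {f g : A → ℕ} → (∀ x → f x ≡ g x) → ∑ xs f ≡ ∑ xs g
∑-cong xs f≗g = cong sum (map-cong f≗g xs)

∑-const : (xs : List A) (c : ℕ) → ∑ xs (λ _ → c) ≡ length xs * c
∑-const []ˡ       c = refl
∑-const (x ∷ˡ xs) c = cong (c +_) (∑-const xs c)

∑-zero : (xs : List A) → ∑ xs (λ _ → 0) ≡ 0
∑-zero xs = trans (∑-const xs 0) (*-zeroʳ (length xs))

∑-constOn : {P : A → Set} {xs : List A} (f : A → ℕ) (c : ℕ) →
            (∀ {x} → P x → f x ≡ c) → All P xs → ∑ xs f ≡ length xs * c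
∑-constOn {xs = xs} f c f≡c Pxs =
  trans (cong sum (map-cong-local (Data.List.Relation.Unary.All.map f≡c Pxs))) (∑-const xs c)

∑-+ : (xs : List A) (f g : A → ℕ) → ∑ xs (λ x → f x + g x) ≡ ∑ xs f + ∑ xs g
∑-+ []ˡ       f g = refl
∑-+ (x ∷ˡ xs) f g = begin
  (f x + g x) + ∑ xs (λ x → f x + g x) ≡⟨ cong (f x + g x +_) (∑-+ xs f g) ⟩
  (f x + g x) + (∑ xs f + ∑ xs g)      ≡⟨ interchange (f x) (g x) _ _ ⟩
  (f x + ∑ xs f) + (g x + ∑ xs g)      ∎

*-distribˡ-∑ : (c : ℕ) (xs : List A) (f : A → ℕ) → c * ∑ xs f ≡ ∑ xs (λ x → c * f x)
*-distribˡ-∑ c []ˡ       f = *-zeroʳ c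
*-distribˡ-∑ c (x ∷ˡ xs) f = trans (*-distribˡ-+ c (f x) _) (cong (c * f x +_) (*-distribˡ-∑ c xs f))

∑-comm : (xs : List A) (ys : List B) (f : A → B → ℕ) →
         ∑ xs (λ x → ∑ ys (f x)) ≡ ∑ ys (λ y → ∑ xs (λ x → f x y))
∑-comm []ˡ       ys f = sym (∑-zero ys)
∑-comm (x ∷ˡ xs) ys f = trans (cong (∑ ys (f x) +_) (∑-comm xs ys f)) (sym (∑-+ ys (f x) _))

∑-even : (xs : List A) (f : A → ℕ) → (∀ x → Even (f x)) → Even (∑ xs f)
∑-even []ˡ       f even = 2 ∣0
∑-even (x ∷ˡ xs) f even = ∣m∣n⇒∣m+n (even x) (∑-even xs f even)

length-filter≡∑χ : {P : A → Set} (P? : Decidable P) (xs : List A) →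
                   length (filter P? xs) ≡ ∑ xs (λ x → χ (does (P? x)))
length-filter≡∑χ P? []ˡ = refl
length-filter≡∑χ P? (x ∷ˡ xs) with does (P? x)
... | true  = cong suc (length-filter≡∑χ P? xs)
... | false = length-filter≡∑χ P? xs

even-χ-* : {P : Set} (P? : Dec P) {x : ℕ} → (P → Even x) → Even (χ (does P?) * x)
even-χ-* (yes p) even = subst Even (sym (+-identityʳ _)) (even p)
even-χ-* (no _)  _    = 2 ∣0

subsets : (n : ℕ) → List (Subset n)
subsets zero    = [] ∷ˡ []ˡ
subsets (suc n) = map (outside ∷_) (subsets n) ++ map (inside ∷_) (subsets n)

#subsetsOfSize : {n : ℕ} → ℕ → Subset n → ℕ
#subsetsOfSize {n} m B = ∑ (subsets n) (λ T → χ (does (∣ T ∣ ≟ m)) * χ (does (T ⊆? B)))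

#subsetsOfSize≡C : (n m : ℕ) (B : Subset n) → #subsetsOfSize m B ≡ ∣ B ∣ C m
#subsetsOfSize≡C zero    zero    [] = refl
#subsetsOfSize≡C zero    (suc m) [] = refl
#subsetsOfSize≡C (suc n) m (x ∷ B) = begin
  ∑ (map (outside ∷_) S ++ map (inside ∷_) S) g      ≡⟨ ∑-++ (map (outside ∷_) S) _ g ⟩
  ∑ (map (outside ∷_) S) g + ∑ (map (inside ∷_) S) g ≡⟨ cong₂ _+_ (∑-map (outside ∷_) S g) (∑-map (inside ∷_) S g) ⟩
  #subsetsOfSize m B + ∑ S (g ∘ (inside ∷_))          ≡⟨ split x m ⟩
  ∣ x ∷ B ∣ C m                                       ∎
  where
  S = subsets n
  g : Subset (suc n) → ℕ
  g T = χ (does (∣ T ∣ ≟ m)) * χ (does (T ⊆? (x ∷ B)))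

  split : ∀ x m → #subsetsOfSize m B
                  + ∑ S (λ T → χ (does (∣ inside ∷ T ∣ ≟ m)) * χ (does ((inside ∷ T) ⊆? (x ∷ B))))
                ≡ ∣ x ∷ B ∣ C m
  split outside m = begin
    #subsetsOfSize m B + ∑ S (λ T → χ (does (suc ∣ T ∣ ≟ m)) * 0) ≡⟨ cong (#subsetsOfSize m B +_) no-inside ⟩
    #subsetsOfSize m B + 0                                       ≡⟨ +-identityʳ _ ⟩
    #subsetsOfSize m B                                           ≡⟨ #subsetsOfSize≡C n m B ⟩
    ∣ B ∣ C m                                                    ∎
    where
    no-inside : ∑ S (λ T → χ (does (suc ∣ T ∣ ≟ m)) * 0) ≡ 0
    no-inside = trans (∑-cong S (λ T → *-zeroʳ (χ (does (suc ∣ T ∣ ≟ m))))) (∑-zero S)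
  split inside zero = begin
    #subsetsOfSize 0 B + ∑ S (λ _ → 0) ≡⟨ cong₂ _+_ (#subsetsOfSize≡C n 0 B) (∑-zero S) ⟩
    1 + 0                              ∎
  split inside (suc m) = begin
    #subsetsOfSize (suc m) B + #subsetsOfSize m B ≡⟨ cong₂ _+_ (#subsetsOfSize≡C n (suc m) B) (#subsetsOfSize≡C n m B) ⟩
    ∣ B ∣ C suc m + ∣ B ∣ C m                     ≡⟨ +-comm (∣ B ∣ C suc m) _ ⟩
    ∣ B ∣ C m + ∣ B ∣ C suc m                     ≡⟨ nCk+nC[k+1]≡[n+1]C[k+1] ∣ B ∣ m ⟩
    suc ∣ B ∣ C suc m                             ∎

suc[m]Cm≡suc[m] : (m : ℕ) → suc m C m ≡ suc m
suc[m]Cm≡suc[m] m = begin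
  suc m C m           ≡⟨ nCk≡nC[n∸k] (n≤1+n m) ⟩
  suc m C (suc m ∸ m) ≡⟨ cong (suc m C_) (m+n∸n≡m 1 m) ⟩
  suc m C 1           ≡⟨ nC1≡n (suc m) ⟩
  suc m               ∎

#incidences : {n : ℕ} → ℕ → List (Subset n) → ℕ
#incidences {n} m U = ∑ (subsets n) (λ T → χ (does (∣ T ∣ ≟ m)) * blocksContaining T U)

#incidences≡∑#subsetsOfSize : {n : ℕ} (m : ℕ) (U : List (Subset n)) →
                              #incidences m U ≡ ∑ U (#subsetsOfSize m)
#incidences≡∑#subsetsOfSize {n} m U = begin
  ∑ (subsets n) (λ T → [ T ] * blocksContaining T U)          ≡⟨ ∑-cong (subsets n) inner ⟩
  ∑ (subsets n) (λ T → ∑ U (λ B → [ T ] * χ (does (T ⊆? B)))) ≡⟨ ∑-comm (subsets n) U _ ⟩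
  ∑ U (#subsetsOfSize m)                                       ∎
  where
  [_] : Subset n → ℕ
  [ T ] = χ (does (∣ T ∣ ≟ m))
  inner : ∀ T → [ T ] * blocksContaining T U ≡ ∑ U (λ B → [ T ] * χ (does (T ⊆? B)))
  inner T = trans (cong ([ T ] *_) (length-filter≡∑χ (T ⊆?_) U)) (*-distribˡ-∑ [ T ] U _)

#incidences-of-uniform : {n : ℕ} (m : ℕ) (U : List (Subset n)) →
                         All (λ B → ∣ B ∣ ≡ suc m) U → #incidences m U ≡ length U * suc m
#incidences-of-uniform {n} m U uniform =
  trans (#incidences≡∑#subsetsOfSize m U) (∑-constOn (#subsetsOfSize m) (suc m) k-subsets uniform)
  where
  k-subsets : {B : Subset n} → ∣ B ∣ ≡ suc m → #subsetsOfSize m B ≡ suc m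
  k-subsets {B} ∣B∣≡suc[m] = begin
    #subsetsOfSize m B ≡⟨ #subsetsOfSize≡C n m B ⟩
    ∣ B ∣ C m          ≡⟨ cong (_C m) ∣B∣≡suc[m] ⟩
    suc m C m          ≡⟨ suc[m]Cm≡suc[m] m ⟩
    suc m              ∎

even-#incidences : {n : ℕ} (m : ℕ) (U : List (Subset n)) →
                   (∀ T → suc ∣ T ∣ ≡ suc m → Even (blocksContaining T U)) → Even (#incidences m U)
even-#incidences m U evenCover =
  ∑-even (subsets _) _ (λ T → even-χ-* (∣ T ∣ ≟ m) (evenCover T ∘ cong suc))

even-*-odd⇒even : ∀ {a k} → Odd k → Even (a * k) → Even a
even-*-odd⇒even {a} {k} odd even with euclidsLemma a k (from-yes (prime? 2)) even
... | inj₁ 2∣a = 2∣a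
... | inj₂ 2∣k = ⊥-elim (odd 2∣k)

proposition11 : (n k : ℕ) (U : List (Subset n)) → Odd k → IsUnitrade n k U → Even (length U)
proposition11 n zero    U odd _ = ⊥-elim (odd (2 ∣0))
proposition11 n (suc m) U odd u = even-*-odd⇒even odd
  (subst Even (#incidences-of-uniform m U blockSize) (even-#incidences m U evenCover))
  where open IsUnitrade u
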